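{- Let $H$ be a graph with a function $f:V(H)\to\mathbb Z$, and let $\mathcal H$ be a subgraph partition of $H$. A part $H_i\in\mathcal H$ is an $f$-weak part of $\mathcal H$ if one of the following holds: (1) $H_i$ is obtained from a petal graph with root $r$ and path $P=(v_1,\dots,v_t)$ by deleting the edge $rv_t$, where $2\le t\le 4$, $f(r)\ge\deg_H(r)+1$, $f(v)\ge\deg_H(v)$ for each $v\in V(P)$, $v_1$ has a neighbor in some part $H_j\in\mathcal H\setminus\{H_i\}$, and $v_t$ has a neighbor in some part $H_{j'}\in\mathcal H\setminus\{H_i,H_j\}$; (2) $H_i$ is a path $(v_1,v_2,v_3)$ with $f(v_1)\ge\deg_H(v_1)$, $f(v_2)\ge\deg_H(v_2)+1$, $f(v_3)\ge\deg_H(v_3)$, $v_1$ has a neighbor in some part $H_j\in\mathcal H\setminus\{H_i\}$, and $v_3$ has a neighbor in some part $H_{j'}\in\mathcal H\setminus\{H_i,H_j\}$.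
   Context: All graphs are finite and simple. A petal graph is obtained from a path $P$ by adding a vertex $r$ (the root) adjacent to every vertex of $P$. A subgraph partition of $H$ is a family $\mathcal H$ of induced subgraphs of $H$ whose vertex sets partition $V(H)$. For $g:V(X)\to\mathbb Z$, a $g$-assignment on $X$ assigns each $v$ a set $L(v)\subseteq\mathbb N$ with $|L(v)|=\max\{0,g(v)\}$; an $L$-coloring is a proper coloring $\phi$ with $\phi(v)\in L(v)$; $X$ is $g$-choosable if it has an $L$-coloring for every $g$-assignment $L$. For a list assignment $L$ on $X$: (FIX') holds if for every $v$ and $c\in L(v)$ some $L$-coloring has $\phi(v)=c$; (FORB-2) holds if for every $v_1,v_2\in V(X)$ (not necessarily distinct) and every $c\in L(v_1)\cup L(v_2)$ some $L$-coloring has $\phi(v_1)\ne c\ne\phi(v_2)$. For $U\subseteq V(H)$, $f^U:V(H)\setminus U\to\mathbb Z$ is $f^U(v)=f(v)-|N_H(v)\cap U|$, and $f^X=f^{V(X)}$ for a subgraph $X$. A part $H_i\in\mathcal H$ is $f$-weak if (1) for every $f|_{V(H_i)}$-assignment on $H_i$, (FIX') and (FORB-2) hold; and (2) for every pair $H_j,H_{j'}\in\mathcal H\setminus\{H_i\}$, $H_i$ is $f^{H_j\cup H_{j'}}|_{V(H_i)}$-choosable. -}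

module Defs where

open import Data.Nat using (ℕ; zero; suc; _+_; _≤_; _<_)
open import Data.Integer as ℤ using (ℤ; +_; -[1+_])
open import Data.Fin using (Fin; zero; suc; toℕ; _≟_)
open import Data.Bool using (Bool; true; false; _∧_; _∨_; if_then_else_)
open import Data.List using (List; length)
open import Data.List.Membership.Propositional using (_∈_)
open import Data.List.Relation.Unary.Unique.Propositional using (Unique)
open import Data.Product using (Σ; ∃; _×_; _,_)
open import Data.Sum using (_⊎_)
open import Relation.Nullary using (¬_; does)
open import Relation.Binary.PropositionalEquality using (_≡_; _≢_)

record Graph (n : ℕ) : Set where
  field
    adj    : Fin n → Fin n → Bool
    sym    : ∀ u v → adj u v ≡ adj v u
    irrefl : ∀ v → adj v v ≡ false
open Graph public

count : ∀ {n} → (Fin n → Bool) → ℕ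
count {zero}  p = 0
count {suc n} p = (if p zero then 1 else 0) + count (λ x → p (suc x))

deg : ∀ {n} → Graph n → Fin n → ℕ
deg H v = count (λ u → adj H v u)

pos : ℤ → ℕ
pos (+ m)      = m
pos -[1+ m ]   = 0

-- A subgraph partition of H into k parts: vertex v lies in part (part v);
-- the part H_i is the subgraph of H induced by {v | part v ≡ i}.
-- Parts are nonempty (part is surjective).
IsSubgraphPartition : ∀ {n k} → (Fin n → Fin k) → Set
IsSubgraphPartition {n} {k} part = ∀ (i : Fin k) → ∃ λ (v : Fin n) → part v ≡ i

module _ {n k : ℕ} (H : Graph n) (part : Fin n → Fin k) (i : Fin k) where

  -- a g-assignment on H_i (only the values on V(H_i) matter);
  -- a list of colours is a set: duplicate-free with max{0,g v} elements
  IsAssignment : (Fin n → ℤ) → (Fin n → List ℕ) → Set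
  IsAssignment g L = ∀ v → part v ≡ i → Unique (L v) × length (L v) ≡ pos (g v)

  IsLColoring : (Fin n → List ℕ) → (Fin n → ℕ) → Set
  IsLColoring L φ =
    (∀ v → part v ≡ i → φ v ∈ L v) ×
    (∀ u v → part u ≡ i → part v ≡ i → adj H u v ≡ true → φ u ≢ φ v)

  Choosable : (Fin n → ℤ) → Set
  Choosable g = ∀ L → IsAssignment g L → ∃ λ φ → IsLColoring L φ

  FIX' : (Fin n → List ℕ) → Set
  FIX' L = ∀ v → part v ≡ i → ∀ c → c ∈ L v →
           ∃ λ φ → IsLColoring L φ × φ v ≡ c

  FORB-2 : (Fin n → List ℕ) → Set
  FORB-2 L = ∀ v₁ v₂ → part v₁ ≡ i → part v₂ ≡ i → ∀ c → (c ∈ L v₁ ⊎ c ∈ L v₂) →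
             ∃ λ φ → IsLColoring L φ × φ v₁ ≢ c × φ v₂ ≢ c

  fMinus : (Fin n → ℤ) → Fin k → Fin k → Fin n → ℤ
  fMinus f j j' v =
    f v ℤ.- + count (λ u → adj H v u ∧ (does (part u ≟ j) ∨ does (part u ≟ j')))

  IsWeak : (Fin n → ℤ) → Set
  IsWeak f =
    (∀ L → IsAssignment f L → FIX' L × FORB-2 L) ×
    (∀ j j' → j ≢ i → j' ≢ i → j ≢ j' → Choosable (fMinus f j j'))

-- Each part of type (1) or (2) is isomorphic to a fixed small graph G: the petal
-- graph minus its last spoke (t ≤ 4), or the path on three vertices.  The
-- hypotheses on f bound every list size from below by "degree in G + excess",
-- where the excess is 1 when f(v) ≥ deg_H(v) + 1 or when v has a neighbour in
-- another part (that neighbour is counted in deg_H(v) but not in G); passing to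
-- f^{H_j ∪ H_j'} only removes neighbours outside H_i, so it keeps the bound.
-- All three properties then follow from greedy colouring along an elimination
-- order: FIX' shrinks the list of one vertex to {c}, FORB-2 deletes c from two
-- lists, and choosability uses the bounds as they are.  As G is fixed, the orders
-- are found by a search and checked by evaluation.

module Submission where

open import Defs hiding (sym)
open import Data.Nat using (ℕ; suc; _+_; _≤_; _<_)
open import Data.Integer using (ℤ; +_; _≥_)
open import Data.Fin using (Fin; toℕ)
open import Data.Bool using (Bool; true)
open import Data.Product using (Σ; ∃; _×_; _,_)
open import Data.Sum using (_⊎_)
open import Function.Definitions using (Injective)
open import Relation.Binary.PropositionalEquality using (_≡_; _≢_)
open import Function.Bundles using (_⇔_)

open import Data.Nat using (zero; _∸_; z≤n; s≤s; s≤s⁻¹; _<?_) renaming (_≟_ to _≟ₙ_)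
open import Data.Nat.Properties
  using (≤-refl; ≤-trans; ≤-reflexive; <-≤-trans; +-suc; +-identityʳ; +-mono-≤; +-monoˡ-≤; +-monoʳ-≤;
         m≤m+n; m≤n+m; ∸-monoˡ-≤; m+n≤o⇒m≤o∸n; 1+n≢n; +-commutativeSemigroup; module ≤-Reasoning)
open import Algebra.Properties.CommutativeSemigroup +-commutativeSemigroup using (xy∙z≈xz∙y)
open import Data.Integer as ℤ using (_⊖_; +≤+)
open import Data.Integer.Properties using ([+m]-[+n]≡m⊖n; [1+m]⊖[1+n]≡m⊖n)
open import Data.Fin using (zero; suc; _≟_)
open import Data.Fin.Properties using (0≢1+n; suc-injective; all?)
open import Data.Bool using (false; not; _∧_; _∨_; if_then_else_; T?)
open import Data.Bool.Properties using (T-≡; ∨-comm; ∧-identityʳ; ∧-zeroʳ; ∧-conicalˡ; ¬-not)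
open import Data.List using (List; []; _∷_; [_]; length; filter; map; find; allFin)
open import Data.List.Properties using (length-map; filter-all; filter-notAll; filter-accept; filter-reject)
open import Data.List.Membership.Propositional using (_∈_; _∉_)
open import Data.List.Membership.Propositional.Properties using (∈-filter⁺; ∈-filter⁻; ∈-map⁺)
open import Data.List.Membership.DecPropositional _≟ₙ_ using (_∈?_)
open import Data.List.Relation.Unary.All using ([])
import Data.List.Relation.Unary.All as All
open import Data.List.Relation.Unary.AllPairs using ([]; _∷_)
open import Data.List.Relation.Unary.Any using (here; there)
import Data.List.Relation.Unary.Any as Any
open import Data.List.Relation.Unary.Unique.Propositional using (Unique)
open import Data.List.Relation.Unary.Unique.Propositional.Properties using (filter⁺)
open import Data.Maybe using (just; nothing)
open import Data.Product using (proj₁; proj₂)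
open import Data.Sum using (inj₁; inj₂)
open import Data.Unit using (⊤; tt)
open import Data.Vec.Functional using (updateAt)
open import Data.Vec.Functional.Properties using (updateAt-updates; updateAt-minimal)
open import Function using (_∘_; id; const)
open import Function.Bundles using (Equivalence)
open import Relation.Nullary using (Dec; yes; no; does; ¬?; contradiction)
open import Relation.Nullary.Decidable using (_×-dec_; _⊎-dec_; dec-true; dec-false; from-yes)
open import Relation.Binary.PropositionalEquality using (refl; sym; trans; cong; subst)
import Data.List.Membership.DecPropositional

count-split : ∀ {n} (p q : Fin n → Bool) →
              count p ≡ count (λ x → p x ∧ q x) + count (λ x → p x ∧ not (q x))
count-split {zero}  p q = refl
count-split {suc n} p q rewrite count-split (p ∘ suc) (q ∘ suc) with p zero | q zero
... | true  | true  = refl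
... | true  | false = sym (+-suc _ _)
... | false | _     = refl

count-mono : ∀ {n} {p q : Fin n → Bool} → (∀ x → p x ≡ true → q x ≡ true) → count p ≤ count q
count-mono {zero}          p⇒q = z≤n
count-mono {suc n} {p} {q} p⇒q = +-mono-≤ head (count-mono (p⇒q ∘ suc))
  where
  head : (if p zero then 1 else 0) ≤ (if q zero then 1 else 0)
  head with p zero in p0
  ... | false = z≤n
  ... | true rewrite p⇒q zero p0 = ≤-refl

count-true : ∀ {n} (p : Fin n → Bool) x → p x ≡ true → 1 ≤ count p
count-true p zero    px rewrite px = s≤s z≤n
count-true p (suc x) px = ≤-trans (count-true (p ∘ suc) x px) (m≤n+m _ _)

count-∘-injective : ∀ {m n} (e : Fin m → Fin n) → Injective _≡_ _≡_ e →
                    ∀ p → count (p ∘ e) ≤ count p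
count-∘-injective {zero}  e e-inj p = z≤n
count-∘-injective {suc m} e e-inj p = begin
  (if p w then 1 else 0) + count (p ∘ e ∘ suc) ≤⟨ +-mono-≤ at-w elsewhere ⟩
  count (λ x → p x ∧ is-w x) + count (λ x → p x ∧ not (is-w x)) ≡⟨ sym (count-split p is-w) ⟩
  count p ∎
  where
  open ≤-Reasoning
  w = e zero
  is-w : _ → Bool
  is-w x = does (x ≟ w)
  at-w : (if p w then 1 else 0) ≤ count (λ x → p x ∧ is-w x)
  at-w with p w in pw
  ... | false = z≤n
  ... | true  = count-true _ w (trans (cong (_∧ is-w w) pw) (dec-true (w ≟ w) refl))
  elsewhere : count (p ∘ e ∘ suc) ≤ count (λ x → p x ∧ not (is-w x))
  elsewhere = ≤-trans (count-mono keep) (count-∘-injective (e ∘ suc) (suc-injective ∘ e-inj) _)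
    where
    keep : ∀ x → p (e (suc x)) ≡ true → p (e (suc x)) ∧ not (is-w (e (suc x))) ≡ true
    keep x px rewrite px | dec-false (e (suc x) ≟ w) (0≢1+n ∘ sym ∘ e-inj) = refl

pos-mono : ∀ {z k} → z ≥ + k → k ≤ pos z
pos-mono (+≤+ k≤m) = k≤m

pos-⊖ : ∀ m n → pos (m ⊖ n) ≡ m ∸ n
pos-⊖ zero    zero    = refl
pos-⊖ zero    (suc n) = refl
pos-⊖ (suc m) zero    = refl
pos-⊖ (suc m) (suc n) rewrite [1+m]⊖[1+n]≡m⊖n m n = pos-⊖ m n

pos-∸ : ∀ {z k} c → z ≥ + k → k ∸ c ≤ pos (z ℤ.- + c)
pos-∸ {+ m} c (+≤+ k≤m) rewrite [+m]-[+n]≡m⊖n m c | pos-⊖ m c = ∸-monoˡ-≤ c k≤m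

without : ℕ → List ℕ → List ℕ
without c = filter (¬? ∘ (c ≟ₙ_))

length-without< : ∀ {c ys} → c ∈ ys → length (without c ys) < length ys
length-without< {c} {ys} c∈ys =
  filter-notAll (¬? ∘ (c ≟ₙ_)) ys (Any.map (λ c≡y c≢y → c≢y c≡y) c∈ys)

length≤suc-length-without : ∀ c {xs} → Unique xs → length xs ≤ suc (length (without c xs))
length≤suc-length-without c {[]}     _ = z≤n
length≤suc-length-without c {x ∷ xs} (x∉xs ∷ xs!) with c ≟ₙ x
... | yes refl = ≤-reflexive (cong (suc ∘ length) (sym drops-c))
  where
  drops-c : without c (c ∷ xs) ≡ xs
  drops-c = trans (filter-reject (¬? ∘ (c ≟ₙ_)) (λ c≢c → c≢c refl))
                  (filter-all (¬? ∘ (c ≟ₙ_)) x∉xs)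
... | no c≢x = begin
  suc (length xs)                    ≤⟨ s≤s (length≤suc-length-without c xs!) ⟩
  suc (suc (length (without c xs)))  ≡⟨ cong (suc ∘ length) (filter-accept (¬? ∘ (c ≟ₙ_)) c≢x) ⟨
  suc (length (without c (x ∷ xs)))  ∎
  where open ≤-Reasoning

fresh : ∀ {xs ys : List ℕ} → Unique xs → length ys < length xs → ∃ λ c → c ∈ xs × c ∉ ys
fresh {x ∷ xs} {ys} (x∉xs ∷ xs!) ys<x∷xs with x ∈? ys
... | no x∉ys = x , here refl , x∉ys
... | yes x∈ys with fresh xs! (<-≤-trans (length-without< x∈ys) (s≤s⁻¹ ys<x∷xs))
...   | c , c∈xs , c∉ys-x =
  c , there c∈xs , λ c∈ys → c∉ys-x (∈-filter⁺ (¬? ∘ (x ≟ₙ_)) c∈ys (All.lookup x∉xs c∈xs))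

≡-does : ∀ {P : Set} {x : Bool} (P? : Dec P) → (x ≡ true ⇔ P) → x ≡ does P?
≡-does {x = true}  P? x⇔P = sym (dec-true P? (Equivalence.to x⇔P refl))
≡-does {x = false} P? x⇔P = sym (dec-false P? (λ p → contradiction (Equivalence.from x⇔P p) λ ()))

≥-+0 : ∀ {z n} → z ≥ + n → z ≥ + (n + 0)
≥-+0 {n = n} rewrite +-identityʳ n = id

module ListColouring {m : ℕ} (G : Graph m) where

  Colouring : (Fin m → List ℕ) → (Fin m → ℕ) → Set
  Colouring L φ = (∀ a → φ a ∈ L a) × (∀ a b → adj G a b ≡ true → φ a ≢ φ b)

  Assignment≥ : (Fin m → ℕ) → (Fin m → List ℕ) → Set
  Assignment≥ b L = ∀ a → Unique (L a) × b a ≤ length (L a)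

  Choosable≥ : (Fin m → ℕ) → Set
  Choosable≥ b = ∀ L → Assignment≥ b L → ∃ (Colouring L)

  Fixable : (Fin m → ℕ) → Set
  Fixable b = ∀ L → Assignment≥ b L → ∀ a c → c ∈ L a → ∃ λ φ → Colouring L φ × φ a ≡ c

  Forbiddable : (Fin m → ℕ) → Set
  Forbiddable b = ∀ L → Assignment≥ b L → ∀ a₁ a₂ c →
                  ∃ λ φ → Colouring L φ × φ a₁ ≢ c × φ a₂ ≢ c

  pin : Fin m → (Fin m → ℕ) → Fin m → ℕ
  pin a b = updateAt b a (const 1)

  fixable : ∀ {b} → (∀ a → Choosable≥ (pin a b)) → Fixable b
  fixable {b} choose L L≥ a c c∈La = pinned (choose a L′ L′≥)
    where
    L′ = updateAt L a (const [ c ])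
    L′≥ : Assignment≥ (pin a b) L′
    L′≥ x with x ≟ a
    ... | yes refl rewrite updateAt-updates a {const [ c ]} L | updateAt-updates a {const 1} b = [] ∷ [] , ≤-refl
    ... | no x≢a rewrite updateAt-minimal x a {const [ c ]} L x≢a | updateAt-minimal x a {const 1} b x≢a = L≥ x
    L′a : ∀ {y} → y ∈ L′ a → y ≡ c
    L′a y∈ with here y≡c ← subst (_ ∈_) (updateAt-updates a L) y∈ = y≡c
    L′⊆L : ∀ x {y} → y ∈ L′ x → y ∈ L x
    L′⊆L x y∈ with x ≟ a
    ... | yes refl = subst (_∈ L a) (sym (L′a y∈)) c∈La
    ... | no x≢a = subst (_ ∈_) (updateAt-minimal x a L x≢a) y∈
    pinned : ∃ (Colouring L′) → ∃ λ φ → Colouring L φ × φ a ≡ c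
    pinned (φ , φ∈L′ , proper) = φ , ((λ x → L′⊆L x (φ∈L′ x)) , proper) , L′a (φ∈L′ a)

  shrink : Fin m → Fin m → (Fin m → ℕ) → Fin m → ℕ
  shrink a₁ a₂ b x with x ≟ a₁ ⊎-dec x ≟ a₂
  ... | yes _ = b x ∸ 1
  ... | no _  = b x

  forbiddable : ∀ {b} → (∀ a₁ a₂ → Choosable≥ (shrink a₁ a₂ b)) → Forbiddable b
  forbiddable {b} choose L L≥ a₁ a₂ c = avoiding (choose a₁ a₂ L′ L′≥)
    where
    L′ : Fin m → List ℕ
    L′ x with x ≟ a₁ ⊎-dec x ≟ a₂
    ... | yes _ = without c (L x)
    ... | no _  = L x
    L′≥ : Assignment≥ (shrink a₁ a₂ b) L′
    L′≥ x with x ≟ a₁ ⊎-dec x ≟ a₂ | L≥ x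
    ... | yes _ | L! , b≤ =
      filter⁺ _ L! , ≤-trans (∸-monoˡ-≤ 1 b≤) (∸-monoˡ-≤ 1 (length≤suc-length-without c L!))
    ... | no _  | L≥x     = L≥x
    L′⊆L : ∀ x {y} → y ∈ L′ x → y ∈ L x
    L′⊆L x y∈ with x ≟ a₁ ⊎-dec x ≟ a₂
    ... | yes _ = proj₁ (∈-filter⁻ (¬? ∘ (c ≟ₙ_)) {xs = L x} y∈)
    ... | no _  = y∈
    L′-avoids : ∀ x → x ≡ a₁ ⊎ x ≡ a₂ → ∀ {y} → y ∈ L′ x → y ≢ c
    L′-avoids x hit y∈ with x ≟ a₁ ⊎-dec x ≟ a₂
    ... | yes _   = λ y≡c → proj₂ (∈-filter⁻ (¬? ∘ (c ≟ₙ_)) {xs = L x} y∈) (sym y≡c)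
    ... | no miss = contradiction hit miss
    avoiding : ∃ (Colouring L′) → ∃ λ φ → Colouring L φ × φ a₁ ≢ c × φ a₂ ≢ c
    avoiding (φ , φ∈L′ , proper) =
      φ , ((λ x → L′⊆L x (φ∈L′ x)) , proper) ,
      L′-avoids a₁ (inj₁ refl) (φ∈L′ a₁) , L′-avoids a₂ (inj₂ refl) (φ∈L′ a₂)

  neighboursIn : Fin m → List (Fin m) → List (Fin m)
  neighboursIn a = filter (T? ∘ adj G a)

  -- The head of an order is coloured last, after all of its neighbours in the tail.
  Peelable : (Fin m → ℕ) → List (Fin m) → Set
  Peelable b []          = ⊤
  Peelable b (a ∷ order) = length (neighboursIn a order) < b a × Peelable b order

  peelable? : ∀ b order → Dec (Peelable b order)
  peelable? b []          = yes tt
  peelable? b (a ∷ order) = length (neighboursIn a order) <? b a ×-dec peelable? b order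

  ColouringOn : List (Fin m) → (Fin m → List ℕ) → (Fin m → ℕ) → Set
  ColouringOn S L φ = (∀ {a} → a ∈ S → φ a ∈ L a)
                    × (∀ {a b} → a ∈ S → b ∈ S → adj G a b ≡ true → φ a ≢ φ b)

  extend-colouring : ∀ {L a order ψ} → Unique (L a) → length (neighboursIn a order) < length (L a) →
                     ColouringOn order L ψ → ∃ (ColouringOn (a ∷ order) L)
  extend-colouring {L} {a} {order} {ψ} La! few (ψ∈L , ψ-proper) = φ , φ∈L , φ-proper
    where
    taken = map ψ (neighboursIn a order)
    free : ∃ λ c → c ∈ L a × c ∉ taken
    free = fresh La! (subst (_< length (L a)) (sym (length-map ψ (neighboursIn a order))) few)
    c = proj₁ free
    φ = updateAt ψ a (const c)
    φ-a : φ a ≡ c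
    φ-a = updateAt-updates a ψ
    φ-other : ∀ {x} → x ≢ a → φ x ≡ ψ x
    φ-other x≢a = updateAt-minimal _ a ψ x≢a
    c-avoids : ∀ {x} → x ∈ order → adj G a x ≡ true → c ≢ ψ x
    c-avoids x∈ ax c≡ψx = proj₂ (proj₂ free)
      (subst (_∈ taken) (sym c≡ψx)
        (∈-map⁺ ψ (∈-filter⁺ (T? ∘ adj G a) x∈ (Equivalence.from T-≡ ax))))
    later : ∀ {x} → x ∈ a ∷ order → x ≢ a → x ∈ order
    later (here x≡a) x≢a = contradiction x≡a x≢a
    later (there x∈) _   = x∈
    φ∈L : ∀ {x} → x ∈ a ∷ order → φ x ∈ L x
    φ∈L {x} x∈ with x ≟ a
    ... | yes refl = subst (_∈ L a) (sym φ-a) (proj₁ (proj₂ free))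
    ... | no x≢a   = subst (_∈ L x) (sym (φ-other x≢a)) (ψ∈L (later x∈ x≢a))
    φ-proper : ∀ {x y} → x ∈ a ∷ order → y ∈ a ∷ order → adj G x y ≡ true → φ x ≢ φ y
    φ-proper {x} {y} x∈ y∈ xy with x ≟ a | y ≟ a
    ... | yes refl | yes refl = contradiction (trans (sym xy) (irrefl G a)) λ ()
    ... | yes refl | no y≢a   = λ φa≡φy → c-avoids (later y∈ y≢a) xy
                                           (trans (sym φ-a) (trans φa≡φy (φ-other y≢a)))
    ... | no x≢a   | yes refl = λ φx≡φa → c-avoids (later x∈ x≢a) (trans (Graph.sym G a x) xy)
                                           (trans (sym φ-a) (trans (sym φx≡φa) (φ-other x≢a)))
    ... | no x≢a   | no y≢a   = λ φx≡φy → ψ-proper (later x∈ x≢a) (later y∈ y≢a) xy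
                                           (trans (sym (φ-other x≢a)) (trans φx≡φy (φ-other y≢a)))

  colour-peelable : ∀ {b L} → Assignment≥ b L → ∀ order → Peelable b order → ∃ (ColouringOn order L)
  colour-peelable L≥ []          _                = const 0 , (λ ()) , (λ ())
  colour-peelable L≥ (a ∷ order) (few , peelable) with colour-peelable L≥ order peelable
  ... | _ , colouring = extend-colouring (proj₁ (L≥ a)) (<-≤-trans few (proj₂ (L≥ a))) colouring

  -- Smallest-last search; nothing is proved about it, its output is checked by peelingSucceeds?.
  peelingOrder : (Fin m → ℕ) → List (Fin m)
  peelingOrder b = peel m (allFin m)
    where
    peel : ℕ → List (Fin m) → List (Fin m)
    peel zero    S = []
    peel (suc k) S with find (λ a → length (neighboursIn a S) <? b a) S
    ... | nothing = []
    ... | just a  = a ∷ peel k (filter (λ x → ¬? (x ≟ a)) S)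

  PeelingSucceeds : (Fin m → ℕ) → Set
  PeelingSucceeds b = Peelable b (peelingOrder b) × (∀ a → a ∈ peelingOrder b)

  peelingSucceeds? : ∀ b → Dec (PeelingSucceeds b)
  peelingSucceeds? b = peelable? b (peelingOrder b) ×-dec all? (λ a → Fin-∈._∈?_ a (peelingOrder b))
    where module Fin-∈ = Data.List.Membership.DecPropositional (_≟_ {m})

  choosable-by-peeling : ∀ {b} → PeelingSucceeds b → Choosable≥ b
  choosable-by-peeling (peelable , covers) L L≥ with colour-peelable L≥ _ peelable
  ... | φ , φ∈L , proper = φ , (λ a → φ∈L (covers a)) , λ a b → proper (covers a) (covers b)

  WeakFor : (b₁ b₂ : Fin m → ℕ) → Set
  WeakFor b₁ b₂ = Fixable b₁ × Forbiddable b₁ × Choosable≥ b₂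

  PeelsWeakly : (b₁ b₂ : Fin m → ℕ) → Set
  PeelsWeakly b₁ b₂ = (∀ a → PeelingSucceeds (pin a b₁))
                    × (∀ a₁ a₂ → PeelingSucceeds (shrink a₁ a₂ b₁))
                    × PeelingSucceeds b₂

  peelsWeakly? : ∀ b₁ b₂ → Dec (PeelsWeakly b₁ b₂)
  peelsWeakly? b₁ b₂ = all? (λ a → peelingSucceeds? (pin a b₁))
                     ×-dec all? (λ a₁ → all? λ a₂ → peelingSucceeds? (shrink a₁ a₂ b₁))
                     ×-dec peelingSucceeds? b₂

  weakFor-by-peeling : ∀ {b₁ b₂} → PeelsWeakly b₁ b₂ → WeakFor b₁ b₂
  weakFor-by-peeling (pinned , shrunk , plain) =
    fixable (choosable-by-peeling ∘ pinned) ,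
    forbiddable (λ a₁ a₂ → choosable-by-peeling (shrunk a₁ a₂)) ,
    choosable-by-peeling plain

open ListColouring

record PartIso {n k m} (H : Graph n) (part : Fin n → Fin k) (i : Fin k) (G : Graph m) : Set where
  field
    embed     : Fin m → Fin n
    injective : Injective _≡_ _≡_ embed
    into      : ∀ a → part (embed a) ≡ i
    onto      : ∀ v → part v ≡ i → ∃ λ a → embed a ≡ v
    adj-embed : ∀ a b → adj H (embed a) (embed b) ≡ adj G a b

module Transfer {n k m} {H : Graph n} {part : Fin n → Fin k} {i : Fin k} {G : Graph m}
                (iso : PartIso H part i G) (f : Fin n → ℤ) where
  open PartIso iso

  -- The value 0 off part i is junk: IsLColoring only looks at part i.
  pull : (Fin m → ℕ) → Fin n → ℕ
  pull ψ v with part v ≟ i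
  ... | yes v∈i = ψ (proj₁ (onto v v∈i))
  ... | no _    = 0

  pull-embed : ∀ ψ a → pull ψ (embed a) ≡ ψ a
  pull-embed ψ a with part (embed a) ≟ i
  ... | yes a∈i = cong ψ (injective (proj₂ (onto (embed a) a∈i)))
  ... | no a∉i  = contradiction (into a) a∉i

  pull-colouring : ∀ {L ψ} → Colouring G (L ∘ embed) ψ → IsLColoring H part i L (pull ψ)
  pull-colouring {L} {ψ} (ψ∈L , ψ-proper) = ∈L , proper
    where
    ∈L : ∀ v → part v ≡ i → pull ψ v ∈ L v
    ∈L v v∈i with onto v v∈i
    ... | a , refl = subst (_∈ L (embed a)) (sym (pull-embed ψ a)) (ψ∈L a)
    proper : ∀ u v → part u ≡ i → part v ≡ i → adj H u v ≡ true → pull ψ u ≢ pull ψ v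
    proper u v u∈i v∈i uv with onto u u∈i | onto v v∈i
    ... | a , refl | b , refl = λ eq → ψ-proper a b (trans (sym (adj-embed a b)) uv)
                                         (trans (sym (pull-embed ψ a)) (trans eq (pull-embed ψ b)))

  restrict : ∀ g {L b} → IsAssignment H part i g L → (∀ a → b a ≤ pos (g (embed a))) →
             Assignment≥ G b (L ∘ embed)
  restrict g {b = b} L-assignment b≤ a with L-assignment (embed a) (into a)
  ... | L! , length≡ = L! , subst (b a ≤_) (sym length≡) (b≤ a)

  weakFor⇒isWeak : ∀ {b₁ b₂} → WeakFor G b₁ b₂ →
           (∀ a → b₁ a ≤ pos (f (embed a))) →
           (∀ j j' → j ≢ i → j' ≢ i → ∀ a → b₂ a ≤ pos (fMinus H part i f j j' (embed a))) →
           IsWeak H part i f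
  weakFor⇒isWeak (fixable , forbiddable , choosable) b₁≤ b₂≤ = (λ L A → fix′ L A , forb₂ L A) , choose
    where
    fix′ : ∀ L → IsAssignment H part i f L → FIX' H part i L
    fix′ L A v v∈i c c∈ with onto v v∈i
    ... | a , refl with fixable (L ∘ embed) (restrict f A b₁≤) a c c∈
    ... | ψ , colouring , ψa≡c = pull ψ , pull-colouring colouring , trans (pull-embed ψ a) ψa≡c
    forb₂ : ∀ L → IsAssignment H part i f L → FORB-2 H part i L
    forb₂ L A v₁ v₂ v₁∈i v₂∈i c _ with onto v₁ v₁∈i | onto v₂ v₂∈i
    ... | a₁ , refl | a₂ , refl with forbiddable (L ∘ embed) (restrict f A b₁≤) a₁ a₂ c
    ... | ψ , colouring , ψa₁≢c , ψa₂≢c =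
      pull ψ , pull-colouring colouring ,
      ψa₁≢c ∘ trans (sym (pull-embed ψ a₁)) , ψa₂≢c ∘ trans (sym (pull-embed ψ a₂))
    choose : ∀ j j' → j ≢ i → j' ≢ i → j ≢ j' → Choosable H part i (fMinus H part i f j j')
    choose j j' j≢i j'≢i _ L A
      with choosable (L ∘ embed) (restrict (fMinus H part i f j j') A (b₂≤ j j' j≢i j'≢i))
    ... | ψ , colouring = pull ψ , pull-colouring colouring

  inPart : Fin n → Bool
  inPart u = does (part u ≟ i)

  internalDeg externalDeg : Fin n → ℕ
  internalDeg v = count (λ u → adj H v u ∧ inPart u)
  externalDeg v = count (λ u → adj H v u ∧ not (inPart u))

  deg-split : ∀ v → deg H v ≡ internalDeg v + externalDeg v
  deg-split v = count-split (adj H v) inPart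

  deg≤internalDeg : ∀ a → deg G a ≤ internalDeg (embed a)
  deg≤internalDeg a = ≤-trans (count-mono lift-edge) (count-∘-injective embed injective _)
    where
    lift-edge : ∀ b → adj G a b ≡ true → adj H (embed a) (embed b) ∧ inPart (embed b) ≡ true
    lift-edge b ab rewrite adj-embed a b | ab | dec-true (part (embed b) ≟ i) (into b) = refl

  deg≤deg : ∀ a → deg G a ≤ deg H (embed a)
  deg≤deg a = ≤-trans (deg≤internalDeg a) (≤-trans (m≤m+n _ _) (≤-reflexive (sym (deg-split (embed a)))))

  externalDeg-pos : ∀ {v u} → part u ≢ i → adj H v u ≡ true → 1 ≤ externalDeg v
  externalDeg-pos {v} {u} u∉i vu = count-true _ u outside
    where
    outside : adj H v u ∧ not (inPart u) ≡ true
    outside rewrite vu | dec-false (part u ≟ i) u∉i = refl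

  degToParts : Fin k → Fin k → Fin n → ℕ
  degToParts j j' v = count (λ u → adj H v u ∧ (does (part u ≟ j) ∨ does (part u ≟ j')))

  degToParts≤externalDeg : ∀ {j j'} → j ≢ i → j' ≢ i → ∀ v → degToParts j j' v ≤ externalDeg v
  degToParts≤externalDeg {j} {j'} j≢i j'≢i v = count-mono outside
    where
    outside : ∀ u → adj H v u ∧ (does (part u ≟ j) ∨ does (part u ≟ j')) ≡ true →
              adj H v u ∧ not (inPart u) ≡ true
    outside u vu∧u∈jj' with part u ≟ i
    ... | no _ = trans (∧-identityʳ _) (∧-conicalˡ _ _ vu∧u∈jj')
    ... | yes u∈i
      rewrite dec-false (part u ≟ j) (λ u∈j → j≢i (trans (sym u∈j) u∈i))
            | dec-false (part u ≟ j') (λ u∈j' → j'≢i (trans (sym u∈j') u∈i))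
      = contradiction (trans (sym (∧-zeroʳ (adj H v u))) vu∧u∈jj') λ ()

  fBound : ∀ {x} a → f (embed a) ≥ + (deg H (embed a) + x) → deg G a + x ≤ pos (f (embed a))
  fBound {x = x} a fa = ≤-trans (+-monoˡ-≤ x (deg≤deg a)) (pos-mono fa)

  fBound-outside : ∀ a {j} → j ≢ i → f (embed a) ≥ + deg H (embed a) →
                   (∃ λ u → part u ≡ j × adj H (embed a) u ≡ true) → deg G a + 1 ≤ pos (f (embed a))
  fBound-outside a j≢i fa (u , u∈j , au) = begin
    deg G a + 1                                   ≤⟨ +-mono-≤ (deg≤internalDeg a) (externalDeg-pos u∉i au) ⟩
    internalDeg (embed a) + externalDeg (embed a) ≡⟨ sym (deg-split (embed a)) ⟩
    deg H (embed a)                               ≤⟨ pos-mono fa ⟩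
    pos (f (embed a))                             ∎
    where
    open ≤-Reasoning
    u∉i = j≢i ∘ trans (sym u∈j)

  fMinusBound : ∀ {x j j'} → j ≢ i → j' ≢ i → ∀ a → f (embed a) ≥ + (deg H (embed a) + x) →
                deg G a + x ≤ pos (fMinus H part i f j j' (embed a))
  fMinusBound {x} {j} {j'} j≢i j'≢i a fa = begin
    deg G a + x                    ≤⟨ +-monoˡ-≤ x (deg≤internalDeg a) ⟩
    I + x                          ≤⟨ m+n≤o⇒m≤o∸n (I + x) I+x+R≤deg+x ⟩
    deg H v + x ∸ R                ≤⟨ pos-∸ R fa ⟩
    pos (fMinus H part i f j j' v) ∎
    where
    open ≤-Reasoning
    v = embed a
    I = internalDeg v
    E = externalDeg v
    R = degToParts j j' v
    I+x+R≤deg+x : I + x + R ≤ deg H v + x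
    I+x+R≤deg+x = begin
      I + x + R   ≤⟨ +-monoʳ-≤ (I + x) (degToParts≤externalDeg j≢i j'≢i v) ⟩
      I + x + E   ≡⟨ xy∙z≈xz∙y I x E ⟩
      I + E + x   ≡⟨ cong (_+ x) (sym (deg-split v)) ⟩
      deg H v + x ∎

path : ∀ t → Graph t
adj       (path t) a b = does (suc (toℕ a) ≟ₙ toℕ b ⊎-dec suc (toℕ b) ≟ₙ toℕ a)
Graph.sym (path t) a b = ∨-comm (does (suc (toℕ a) ≟ₙ toℕ b)) _
irrefl    (path t) a rewrite dec-false (suc (toℕ a) ≟ₙ toℕ a) 1+n≢n = refl

spoke : ∀ t → Fin t → Bool
spoke t a = does (suc (toℕ a) <? t)

-- Vertex zero is the root r and suc a is the path vertex p a; the root misses only the last one.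
petalMinusLastSpoke : ∀ t → Graph (suc t)
adj (petalMinusLastSpoke t) zero    zero    = false
adj (petalMinusLastSpoke t) zero    (suc b) = spoke t b
adj (petalMinusLastSpoke t) (suc a) zero    = spoke t a
adj (petalMinusLastSpoke t) (suc a) (suc b) = adj (path t) a b
Graph.sym (petalMinusLastSpoke t) zero    zero    = refl
Graph.sym (petalMinusLastSpoke t) zero    (suc b) = refl
Graph.sym (petalMinusLastSpoke t) (suc a) zero    = refl
Graph.sym (petalMinusLastSpoke t) (suc a) (suc b) = Graph.sym (path t) a b
irrefl (petalMinusLastSpoke t) zero    = refl
irrefl (petalMinusLastSpoke t) (suc a) = irrefl (path t) a

-- The excess 1 comes from f r ≥ deg r + 1 at the root and from the outside neighbour at either
-- end of the path.
petalFixBound : ∀ t → Fin (suc t) → ℕ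
petalFixBound t zero    = deg (petalMinusLastSpoke t) zero + 1
petalFixBound t (suc a) with toℕ a ≟ₙ 0 ⊎-dec suc (toℕ a) ≟ₙ t
... | yes _ = deg (petalMinusLastSpoke t) (suc a) + 1
... | no _  = deg (petalMinusLastSpoke t) (suc a) + 0

petalChoiceBound : ∀ t → Fin (suc t) → ℕ
petalChoiceBound t zero    = deg (petalMinusLastSpoke t) zero + 1
petalChoiceBound t (suc a) = deg (petalMinusLastSpoke t) (suc a) + 0

petal-weak : ∀ t → 2 ≤ t → t ≤ 4 → WeakFor (petalMinusLastSpoke t) (petalFixBound t) (petalChoiceBound t)
petal-weak 2 _ _ =
  weakFor-by-peeling _ (from-yes (peelsWeakly? (petalMinusLastSpoke 2) (petalFixBound 2) (petalChoiceBound 2)))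
petal-weak 3 _ _ =
  weakFor-by-peeling _ (from-yes (peelsWeakly? (petalMinusLastSpoke 3) (petalFixBound 3) (petalChoiceBound 3)))
petal-weak 4 _ _ =
  weakFor-by-peeling _ (from-yes (peelsWeakly? (petalMinusLastSpoke 4) (petalFixBound 4) (petalChoiceBound 4)))
petal-weak 1 (s≤s ()) _
petal-weak (suc (suc (suc (suc (suc _))))) _ (s≤s (s≤s (s≤s (s≤s ()))))

-- Excess 1 everywhere: f v₂ ≥ deg v₂ + 1, and v₁, v₃ have a neighbour outside the part.
pathFixBound : Fin 3 → ℕ
pathFixBound a = deg (path 3) a + 1

pathChoiceBound : Fin 3 → ℕ
pathChoiceBound zero          = deg (path 3) zero + 0
pathChoiceBound (suc zero)    = deg (path 3) (suc zero) + 1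
pathChoiceBound (suc (suc a)) = deg (path 3) (suc (suc a)) + 0

path-weak : WeakFor (path 3) pathFixBound pathChoiceBound
path-weak = weakFor-by-peeling _ (from-yes (peelsWeakly? (path 3) pathFixBound pathChoiceBound))

module PetalPart {n k} (H : Graph n) (f : Fin n → ℤ) (part : Fin n → Fin k) (i : Fin k)
  (t : ℕ) (2≤t : 2 ≤ t) (t≤4 : t ≤ 4) (r : Fin n) (p : Fin t → Fin n)
  (p-injective : Injective _≡_ _≡_ p) (p≢r : ∀ a → p a ≢ r)
  (part-i : ∀ v → (part v ≡ i) ⇔ (v ≡ r ⊎ ∃ λ a → p a ≡ v))
  (path-adj : ∀ a b → (adj H (p a) (p b) ≡ true) ⇔ (suc (toℕ a) ≡ toℕ b ⊎ suc (toℕ b) ≡ toℕ a))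
  (spoke-adj : ∀ a → (adj H r (p a) ≡ true) ⇔ (suc (toℕ a) < t))
  (f-root : f r ≥ + (deg H r + 1)) (f-path : ∀ a → f (p a) ≥ + deg H (p a))
  (j j' : Fin k) (j≢i : j ≢ i) (j'≢i : j' ≢ i)
  (first-outside : ∀ a → toℕ a ≡ 0 → ∃ λ u → part u ≡ j × adj H (p a) u ≡ true)
  (last-outside : ∀ a → suc (toℕ a) ≡ t → ∃ λ u → part u ≡ j' × adj H (p a) u ≡ true)
  where

  embed : Fin (suc t) → Fin n
  embed zero    = r
  embed (suc a) = p a

  embed-injective : Injective _≡_ _≡_ embed
  embed-injective {zero}  {zero}  _     = refl
  embed-injective {zero}  {suc b} r≡pb  = contradiction (sym r≡pb) (p≢r b)
  embed-injective {suc a} {zero}  pa≡r  = contradiction pa≡r (p≢r a)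
  embed-injective {suc a} {suc b} pa≡pb = cong suc (p-injective pa≡pb)

  into : ∀ a → part (embed a) ≡ i
  into zero    = Equivalence.from (part-i r) (inj₁ refl)
  into (suc a) = Equivalence.from (part-i (p a)) (inj₂ (a , refl))

  onto : ∀ v → part v ≡ i → ∃ λ a → embed a ≡ v
  onto v v∈i with Equivalence.to (part-i v) v∈i
  ... | inj₁ refl        = zero , refl
  ... | inj₂ (a , pa≡v) = suc a , pa≡v

  adj-embed : ∀ a b → adj H (embed a) (embed b) ≡ adj (petalMinusLastSpoke t) a b
  adj-embed zero    zero    = irrefl H r
  adj-embed zero    (suc b) = ≡-does (suc (toℕ b) <? t) (spoke-adj b)
  adj-embed (suc a) zero    = trans (Graph.sym H (p a) r) (≡-does (suc (toℕ a) <? t) (spoke-adj a))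
  adj-embed (suc a) (suc b) =
    ≡-does (suc (toℕ a) ≟ₙ toℕ b ⊎-dec suc (toℕ b) ≟ₙ toℕ a) (path-adj a b)

  iso : PartIso H part i (petalMinusLastSpoke t)
  iso = record { embed = embed ; injective = embed-injective ; into = into ; onto = onto ; adj-embed = adj-embed }

  open Transfer iso f

  fix-bound : ∀ a → petalFixBound t a ≤ pos (f (embed a))
  fix-bound zero = fBound zero f-root
  fix-bound (suc a) with toℕ a ≟ₙ 0 ⊎-dec suc (toℕ a) ≟ₙ t
  ... | yes (inj₁ first) = fBound-outside (suc a) j≢i  (f-path a) (first-outside a first)
  ... | yes (inj₂ last)  = fBound-outside (suc a) j'≢i (f-path a) (last-outside a last)
  ... | no _             = fBound (suc a) (≥-+0 (f-path a))

  choice-bound : ∀ j j' → j ≢ i → j' ≢ i → ∀ a →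
                 petalChoiceBound t a ≤ pos (fMinus H part i f j j' (embed a))
  choice-bound j j' j≢i j'≢i zero    = fMinusBound j≢i j'≢i zero f-root
  choice-bound j j' j≢i j'≢i (suc a) = fMinusBound j≢i j'≢i (suc a) (≥-+0 (f-path a))

  isWeak : IsWeak H part i f
  isWeak = weakFor⇒isWeak (petal-weak t 2≤t t≤4) fix-bound choice-bound

module PathPart {n k} (H : Graph n) (f : Fin n → ℤ) (part : Fin n → Fin k) (i : Fin k)
  (v₁ v₂ v₃ : Fin n) (v₁≢v₂ : v₁ ≢ v₂) (v₂≢v₃ : v₂ ≢ v₃) (v₁≢v₃ : v₁ ≢ v₃)
  (part-i : ∀ v → (part v ≡ i) ⇔ (v ≡ v₁ ⊎ v ≡ v₂ ⊎ v ≡ v₃))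
  (v₁v₂ : adj H v₁ v₂ ≡ true) (v₂v₃ : adj H v₂ v₃ ≡ true) (v₁≁v₃ : adj H v₁ v₃ ≢ true)
  (f-v₁ : f v₁ ≥ + deg H v₁) (f-v₂ : f v₂ ≥ + (deg H v₂ + 1)) (f-v₃ : f v₃ ≥ + deg H v₃)
  (j j' : Fin k) (j≢i : j ≢ i) (j'≢i : j' ≢ i)
  (v₁-outside : ∃ λ u → part u ≡ j × adj H v₁ u ≡ true)
  (v₃-outside : ∃ λ u → part u ≡ j' × adj H v₃ u ≡ true)
  where

  embed : Fin 3 → Fin n
  embed zero             = v₁
  embed (suc zero)       = v₂
  embed (suc (suc zero)) = v₃

  embed-injective : Injective _≡_ _≡_ embed
  embed-injective {zero}             {zero}             _  = refl
  embed-injective {zero}             {suc zero}         eq = contradiction eq v₁≢v₂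
  embed-injective {zero}             {suc (suc zero)}   eq = contradiction eq v₁≢v₃
  embed-injective {suc zero}         {zero}             eq = contradiction (sym eq) v₁≢v₂
  embed-injective {suc zero}         {suc zero}         _  = refl
  embed-injective {suc zero}         {suc (suc zero)}   eq = contradiction eq v₂≢v₃
  embed-injective {suc (suc zero)}   {zero}             eq = contradiction (sym eq) v₁≢v₃
  embed-injective {suc (suc zero)}   {suc zero}         eq = contradiction (sym eq) v₂≢v₃
  embed-injective {suc (suc zero)}   {suc (suc zero)}   _  = refl

  into : ∀ a → part (embed a) ≡ i
  into zero             = Equivalence.from (part-i v₁) (inj₁ refl)
  into (suc zero)       = Equivalence.from (part-i v₂) (inj₂ (inj₁ refl))
  into (suc (suc zero)) = Equivalence.from (part-i v₃) (inj₂ (inj₂ refl))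

  onto : ∀ v → part v ≡ i → ∃ λ a → embed a ≡ v
  onto v v∈i with Equivalence.to (part-i v) v∈i
  ... | inj₁ refl        = zero , refl
  ... | inj₂ (inj₁ refl) = suc zero , refl
  ... | inj₂ (inj₂ refl) = suc (suc zero) , refl

  v₁v₃ : adj H v₁ v₃ ≡ false
  v₁v₃ = ¬-not v₁≁v₃

  adj-embed : ∀ a b → adj H (embed a) (embed b) ≡ adj (path 3) a b
  adj-embed zero             zero             = irrefl H v₁
  adj-embed zero             (suc zero)       = v₁v₂
  adj-embed zero             (suc (suc zero)) = v₁v₃
  adj-embed (suc zero)       zero             = trans (Graph.sym H v₂ v₁) v₁v₂
  adj-embed (suc zero)       (suc zero)       = irrefl H v₂
  adj-embed (suc zero)       (suc (suc zero)) = v₂v₃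
  adj-embed (suc (suc zero)) zero             = trans (Graph.sym H v₃ v₁) v₁v₃
  adj-embed (suc (suc zero)) (suc zero)       = trans (Graph.sym H v₃ v₂) v₂v₃
  adj-embed (suc (suc zero)) (suc (suc zero)) = irrefl H v₃

  iso : PartIso H part i (path 3)
  iso = record { embed = embed ; injective = embed-injective ; into = into ; onto = onto ; adj-embed = adj-embed }

  open Transfer iso f

  fix-bound : ∀ a → pathFixBound a ≤ pos (f (embed a))
  fix-bound zero             = fBound-outside zero j≢i f-v₁ v₁-outside
  fix-bound (suc zero)       = fBound (suc zero) f-v₂
  fix-bound (suc (suc zero)) = fBound-outside (suc (suc zero)) j'≢i f-v₃ v₃-outside

  choice-bound : ∀ j j' → j ≢ i → j' ≢ i → ∀ a →
                 pathChoiceBound a ≤ pos (fMinus H part i f j j' (embed a))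
  choice-bound j j' j≢i j'≢i zero             = fMinusBound j≢i j'≢i zero (≥-+0 f-v₁)
  choice-bound j j' j≢i j'≢i (suc zero)       = fMinusBound j≢i j'≢i (suc zero) f-v₂
  choice-bound j j' j≢i j'≢i (suc (suc zero)) = fMinusBound j≢i j'≢i (suc (suc zero)) (≥-+0 f-v₃)

  isWeak : IsWeak H part i f
  isWeak = weakFor⇒isWeak path-weak fix-bound choice-bound

lemma3p9 : ∀ {n k : ℕ} (H : Graph n) (f : Fin n → ℤ) (part : Fin n → Fin k)
  → IsSubgraphPartition part → (i : Fin k)
  → ( -- (1) petal graph with root r and path p 0 , … , p (t-1), minus the edge r v_t
      (Σ ℕ λ t → 2 ≤ t × t ≤ 4 × Σ (Fin n) λ r → Σ (Fin t → Fin n) λ p →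
        Injective _≡_ _≡_ p × (∀ a → p a ≢ r)
        × (∀ v → (part v ≡ i) ⇔ (v ≡ r ⊎ ∃ λ a → p a ≡ v))
        × (∀ a b → (adj H (p a) (p b) ≡ true) ⇔ (suc (toℕ a) ≡ toℕ b ⊎ suc (toℕ b) ≡ toℕ a))
        × (∀ a → (adj H r (p a) ≡ true) ⇔ (suc (toℕ a) < t))
        × f r ≥ + (deg H r + 1)
        × (∀ a → f (p a) ≥ + deg H (p a))
        × Σ (Fin k) λ j → Σ (Fin k) λ j' → j ≢ i × j' ≢ i × j' ≢ j
          × (∀ a → toℕ a ≡ 0 → ∃ λ u → part u ≡ j × adj H (p a) u ≡ true)
          × (∀ a → suc (toℕ a) ≡ t → ∃ λ u → part u ≡ j' × adj H (p a) u ≡ true))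
    ⊎ -- (2) a path (v₁ , v₂ , v₃)
      (Σ (Fin n) λ v₁ → Σ (Fin n) λ v₂ → Σ (Fin n) λ v₃ →
        v₁ ≢ v₂ × v₂ ≢ v₃ × v₁ ≢ v₃
        × (∀ v → (part v ≡ i) ⇔ (v ≡ v₁ ⊎ v ≡ v₂ ⊎ v ≡ v₃))
        × adj H v₁ v₂ ≡ true × adj H v₂ v₃ ≡ true × adj H v₁ v₃ ≢ true
        × f v₁ ≥ + deg H v₁ × f v₂ ≥ + (deg H v₂ + 1) × f v₃ ≥ + deg H v₃
        × Σ (Fin k) λ j → Σ (Fin k) λ j' → j ≢ i × j' ≢ i × j' ≢ j
          × (∃ λ u → part u ≡ j × adj H v₁ u ≡ true)
          × (∃ λ u → part u ≡ j' × adj H v₃ u ≡ true)))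
  → IsWeak H part i f
lemma3p9 H f part _ i
  (inj₁ (t , 2≤t , t≤4 , r , p , p-injective , p≢r , part-i , path-adj , spoke-adj , f-root , f-path ,
         j , j' , j≢i , j'≢i , _ , first-outside , last-outside)) =
  PetalPart.isWeak H f part i t 2≤t t≤4 r p p-injective p≢r part-i path-adj spoke-adj f-root f-path
                   j j' j≢i j'≢i first-outside last-outside
lemma3p9 H f part _ i
  (inj₂ (v₁ , v₂ , v₃ , v₁≢v₂ , v₂≢v₃ , v₁≢v₃ , part-i , v₁v₂ , v₂v₃ , v₁≁v₃ ,
         f-v₁ , f-v₂ , f-v₃ ,
         j , j' , j≢i , j'≢i , _ , v₁-outside , v₃-outside)) =
  PathPart.isWeak H f part i v₁ v₂ v₃ v₁≢v₂ v₂≢v₃ v₁≢v₃ part-i v₁v₂ v₂v₃ v₁≁v₃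
                  f-v₁ f-v₂ f-v₃
                  j j' j≢i j'≢i v₁-outside v₃-outside
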